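{- Let $n\ge1$, $w\in S_n$ with $w\ne w_0$, and let $(i,j)$ be an addable cell of $\mathrm{dom}(w)$ with $j=\alpha(w)$. Then: (1) every $u\in\overline\Phi_i(w)$ lies in $S_n$ (i.e. fixes all integers $>n$); (2) $(i+1,j)$ is an addable cell of $\mathrm{dom}(ws_i)$; (3) $\{u\in\overline\Phi_{i+1}(ws_i):u\text{ has a descent at }i\}=\{u\in\overline\Phi_i(w):u>ws_i\}$; (4) the map $u\mapsto us_i$ is a bijection from $\{v\in\Phi_{i+1}(ws_i):v\text{ has a descent at }i\}$ to $\Phi_i(w)\setminus\{ws_i\}$.
   Context: Permutations are bijections of $\mathbb Z_{>0}$ fixing all but finitely many integers; $S_n$ consists of those fixing all integers $>n$; $s_i=(i\ i+1)$, $t_{a,b}=(a\ b)$, $w_0=n\,n-1\cdots1$; Bruhat order; $v$ has a descent at $i$ if $v(i)>v(i+1)$. Rothe diagram $D(w)=\{(i,j):j<w(i),\ i<w^{ -1}(j)\}$; $\mathrm{dom}(w)$ is the largest Young diagram (top-left justified partition shape) contained in $D(w)$; an addable cell of a Young diagram $Y$ is $(i,j)\notin Y$ with $(i-1,j)\in Y$ if $i>1$ and $(i,j-1)\in Y$ if $j>1$. For $w\in S_n\setminus\{w_0\}$, $\alpha(w)$ is the least $j$ such that $\mathrm{dom}(w)$ has an addable cell $(i,j)$ with $i+j\le n$. $\phi_i(w)=\{a>i:w(a)>w(i)$, and no $a'$ with $i<a'<a$ and $w(i)<w(a')<w(a)\}$; $\Phi_i(w)=\{wt_{i,a}:a\in\phi_i(w)\}$;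 $\overline\Phi_i(w)=\{wt_{i,i_k}t_{i,i_{k-1}}\cdots t_{i,i_1}:\emptyset\ne\{i_1<\cdots<i_k\}\subseteq\phi_i(w)\}$. -}

module Defs where

-- Encoding: the positive integers Z>0 are the nonzero elements of ℕ; the
-- value at 0 is junk (all permutations we build fix 0).
open import Data.Nat using (ℕ; zero; suc; _+_; _∸_; _≤_; _<_)
open import Data.Nat.Properties using (_≟_)
open import Data.Product using (Σ; ∃; ∃-syntax; _×_; _,_)
open import Data.List using (List; []; _∷_)
open import Data.List.Relation.Unary.All using (All)
open import Data.List.Relation.Unary.Linked using (Linked)
open import Relation.Nullary using (¬_; yes; no; contradiction)
open import Relation.Binary.PropositionalEquality
  using (_≡_; _≢_; refl; sym; trans; cong; _≗_)
open import Relation.Binary.Construct.Closure.Transitive using (TransClosure)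
open import Function using (_∘_)
open import Function.Bundles using (_↔_; Inverse; mk↔ₛ′)

t : ℕ → ℕ → ℕ → ℕ
t a b x with x ≟ a
... | yes _ = b
... | no _ with x ≟ b
...   | yes _ = a
...   | no _ = x

private
  t-invol : ∀ a b x → t a b (t a b x) ≡ x
  t-invol a b x with x ≟ a
  t-invol a b x | yes x≡a with b ≟ a
  ... | yes b≡a = trans b≡a (sym x≡a)
  ... | no _ with b ≟ b
  ...   | yes _ = sym x≡a
  ...   | no b≢b = contradiction refl b≢b
  t-invol a b x | no x≢a with x ≟ b
  t-invol a b x | no x≢a | yes x≡b with a ≟ a
  ... | yes _ = sym x≡b
  ... | no a≢a = contradiction refl a≢a
  t-invol a b x | no x≢a | no x≢b with x ≟ a
  ... | yes x≡a = contradiction x≡a x≢a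
  ... | no _ with x ≟ b
  ...   | yes x≡b = contradiction x≡b x≢b
  ...   | no _ = refl

s : ℕ → ℕ → ℕ
s i = t i (suc i)

Perm : Set
Perm = ℕ ↔ ℕ

perm : Perm → ℕ → ℕ
perm = Inverse.to

perm⁻¹ : Perm → ℕ → ℕ
perm⁻¹ = Inverse.from

InS : ℕ → Perm → Set
InS n w = perm w 0 ≡ 0 × (∀ x → n < x → perm w x ≡ x)

IsW0 : ℕ → Perm → Set
IsW0 n w = ∀ k → 1 ≤ k → k ≤ n → perm w k ≡ suc n ∸ k

ws : Perm → ℕ → Perm
ws w i = mk↔ₛ′ (perm w ∘ s i) (s i ∘ perm⁻¹ w)
  (λ y → trans (cong (perm w) (t-invol i (suc i) _))
               (Inverse.strictlyInverseˡ w y))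
  (λ x → trans (cong (s i) (Inverse.strictlyInverseʳ w _))
               (t-invol i (suc i) x))

D : Perm → ℕ → ℕ → Set
D w i j = 1 ≤ i × 1 ≤ j × j < perm w i × i < perm⁻¹ w j

-- dom(w): the largest Young diagram (down-closed set of positive cells)
-- contained in D(w).  A cell (a,b) lies in it iff the whole rectangle
-- [1..a]×[1..b] (itself a Young diagram) lies in D(w).
Dom : Perm → ℕ → ℕ → Set
Dom w a b = 1 ≤ a × 1 ≤ b ×
  (∀ a' b' → 1 ≤ a' → a' ≤ a → 1 ≤ b' → b' ≤ b → D w a' b')

Addable : (ℕ → ℕ → Set) → ℕ → ℕ → Set
Addable Y i j = 1 ≤ i × 1 ≤ j × ¬ Y i j ×
  (1 < i → Y (i ∸ 1) j) × (1 < j → Y i (j ∸ 1))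

IsAlpha : ℕ → Perm → ℕ → Set
IsAlpha n w j =
  (∃[ i ] (Addable (Dom w) i j × i + j ≤ n)) ×
  (∀ j' → j' < j → ¬ (∃[ i ] (Addable (Dom w) i j' × i + j' ≤ n)))

φ : ℕ → (ℕ → ℕ) → ℕ → Set
φ i w a = i < a × w i < w a ×
  (∀ a' → i < a' → a' < a → ¬ (w i < w a' × w a' < w a))

Φ : ℕ → (ℕ → ℕ) → (ℕ → ℕ) → Set
Φ i w v = ∃[ a ] (φ i w a × v ≗ (w ∘ t i a))

tprod : ℕ → List ℕ → ℕ → ℕ
tprod i [] x = x
tprod i (a ∷ as) x = tprod i as (t i a x)

Φbar : ℕ → (ℕ → ℕ) → (ℕ → ℕ) → Set
Φbar i w u = ∃[ L ] (L ≢ [] × Linked _<_ L × All (φ i w) L ×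
  u ≗ (w ∘ tprod i L))

Descent : (ℕ → ℕ) → ℕ → Set
Descent v i = v (suc i) < v i

BruhatStep : (ℕ → ℕ) → (ℕ → ℕ) → Set
BruhatStep u v = ∃[ a ] ∃[ b ] (1 ≤ a × a < b × u a < u b × v ≗ (u ∘ t a b))

_<B_ : (ℕ → ℕ) → (ℕ → ℕ) → Set
u <B v = TransClosure BruhatStep u v

{-# OPTIONS --safe #-}
-- Since (i, j) is addable, w(i) = j and w(a) > j for a < i; minimality of α(w) then forces
-- w(i+1) > j, so i is an ascent of w, and i + j ≤ n.
-- (1) An a ∈ φᵢ(w) with a > n would make w map [i, n] injectively into [1, j], impossible as i + j ≤ n.
-- (2) In w sᵢ, position i+1 becomes a left-to-right minimum, with value j.
-- (3, 4) For a > i+1 we have sᵢ t_{i+1,a} = t_{i,a} sᵢ, so w sᵢ t_{i+1,a_k} ⋯ t_{i+1,a_1}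
-- = w t_{i,a_k} ⋯ t_{i,a_1} t_{i,i+1}: conjugation by sᵢ matches Φ̄_{i+1}(w sᵢ) with the elements of
-- Φ̄ᵢ(w) whose index set starts with i+1, and a descent at i with w(a_1) < w(i+1). The other elements
-- of Φ̄ᵢ(w) are not above w sᵢ in Bruhat order, because their prefix sum u(1) + ⋯ + u(i) is smaller
-- than that of w sᵢ, whereas prefix sums can only grow along Bruhat order.
module Submission where

open import Defs
open import Data.Nat using (ℕ; _<_; _≤_; suc)
open import Data.Product using (_×_; ∃-syntax)
open import Relation.Nullary using (¬_)
open import Relation.Binary.PropositionalEquality using (_≗_; _≡_)
open import Function using (_∘_; _⇔_)

open import Algebra.Properties.CommutativeSemigroup using (xy∙z≈zy∙x)
open import Data.Empty using (⊥-elim)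
open import Data.Fin using (Fin; fromℕ<)
import Data.Fin.Properties as Finₚ
open import Data.List using ([]; _∷_)
open import Data.List.Relation.Unary.All as All using (All; []; _∷_)
import Data.List.Relation.Unary.AllPairs as AllPairs
open import Data.List.Relation.Unary.Linked using (Linked; [-]; _∷_)
open import Data.List.Relation.Unary.Linked.Properties using (Linked⇒All; Linked⇒AllPairs)
open import Data.Nat using (zero; pred; _+_; _∸_; z≤n; s≤s; s≤s⁻¹; >-nonZero)
open import Data.Nat.Properties
open import Data.Product using (_,_; proj₁; proj₂)
open import Data.Sum using (inj₁; inj₂; [_,_]′)
open import Function.Bundles using (Inverse; mk⇔; Equivalence)
open import Function.Definitions using (Injective)
open import Relation.Binary.Construct.Closure.Transitive using ([_]; _∷_; _∷ʳ_)
open import Relation.Binary.Definitions using (tri<; tri≈; tri>)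
open import Relation.Binary.PropositionalEquality
  using (_≢_; refl; sym; trans; cong; cong₂; subst; subst₂; ≢-sym; module ≡-Reasoning)
open import Relation.Nullary using (yes; no; contradiction)

t-applyˡ : ∀ a b → t a b a ≡ b
t-applyˡ a b with a ≟ a
... | yes _ = refl
... | no a≢a = contradiction refl a≢a

t-applyʳ : ∀ a b → t a b b ≡ a
t-applyʳ a b with b ≟ a
... | yes b≡a = b≡a
... | no _ with b ≟ b
...   | yes _ = refl
...   | no b≢b = contradiction refl b≢b

t-fix : ∀ {a b x} → x ≢ a → x ≢ b → t a b x ≡ x
t-fix {a} {b} {x} x≢a x≢b with x ≟ a
... | yes x≡a = contradiction x≡a x≢a
... | no _ with x ≟ b
...   | yes x≡b = contradiction x≡b x≢b
...   | no _ = refl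

t-involutive : ∀ a b x → t a b (t a b x) ≡ x
t-involutive a b x with x ≟ a
... | yes x≡a = trans (t-applyʳ a b) (sym x≡a)
... | no x≢a with x ≟ b
...   | yes x≡b = trans (t-applyˡ a b) (sym x≡b)
...   | no x≢b = t-fix x≢a x≢b

t-conj : ∀ {σ : ℕ → ℕ} → Injective _≡_ _≡_ σ →
         ∀ a b x → σ (t a b x) ≡ t (σ a) (σ b) (σ x)
t-conj {σ} σ-injective a b x with x ≟ a
... | yes refl = sym (t-applyˡ (σ a) (σ b))
... | no x≢a with x ≟ b
...   | yes refl = sym (t-applyʳ (σ a) (σ b))
...   | no x≢b = sym (t-fix (x≢a ∘ σ-injective) (x≢b ∘ σ-injective))

s-involutive : ∀ i x → s i (s i x) ≡ x
s-involutive i = t-involutive i (suc i)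

s-injective : ∀ i → Injective _≡_ _≡_ (s i)
s-injective i {x} {y} six≡siy =
  trans (sym (s-involutive i x)) (trans (cong (s i) six≡siy) (s-involutive i y))

s-conj : ∀ {i a} → suc i < a → ∀ x → s i (t (suc i) a x) ≡ t i a (s i x)
s-conj {i} {a} i+1<a x =
  trans (t-conj (s-injective i) (suc i) a x)
        (cong₂ (λ b c → t b c (s i x)) (t-applyʳ i (suc i)) (t-fix a≢i a≢i+1))
  where
  a≢i+1 : a ≢ suc i
  a≢i+1 = ≢-sym (<⇒≢ i+1<a)
  a≢i : a ≢ i
  a≢i = ≢-sym (<⇒≢ (<-trans (n<1+n i) i+1<a))

∘s-cancelʳ : ∀ {f g : ℕ → ℕ} i → (f ∘ s i) ≗ (g ∘ s i) → f ≗ g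
∘s-cancelʳ {f} {g} i fs≗gs x =
  trans (cong f (sym (s-involutive i x))) (trans (fs≗gs (s i x)) (cong g (s-involutive i x)))

head<tail : ∀ {a as} → Linked _<_ (a ∷ as) → All (a <_) as
head<tail = AllPairs.head ∘ Linked⇒AllPairs <-trans

tprod-fix : ∀ k L {x} → x ≢ k → All (x ≢_) L → tprod k L x ≡ x
tprod-fix k [] _ _ = refl
tprod-fix k (a ∷ as) x≢k (x≢a ∷ x≢as) =
  trans (cong (tprod k as) (t-fix x≢k x≢a)) (tprod-fix k as x≢k x≢as)

tprod-head : ∀ {k a as} → k < a → All (a <_) as → tprod k (a ∷ as) k ≡ a
tprod-head {k} {a} {as} k<a a<as =
  trans (cong (tprod k as) (t-applyˡ k a))
        (tprod-fix k as (≢-sym (<⇒≢ k<a)) (All.map <⇒≢ a<as))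

tprod-conj : ∀ i L → All (suc i <_) L → ∀ x → s i (tprod (suc i) L x) ≡ tprod i L (s i x)
tprod-conj i [] _ x = refl
tprod-conj i (a ∷ as) (i+1<a ∷ i+1<as) x =
  trans (tprod-conj i as i+1<as (t (suc i) a x)) (cong (tprod i as) (s-conj i+1<a x))

perm-injective : (f : Perm) → Injective _≡_ _≡_ (perm f)
perm-injective f {x} {y} fx≡fy =
  trans (sym (Inverse.strictlyInverseʳ f x))
        (trans (cong (perm⁻¹ f) fx≡fy) (Inverse.strictlyInverseʳ f y))

ExceedsBelow : (ℕ → ℕ) → ℕ → ℕ → Set
ExceedsBelow f p q = ∀ x → 1 ≤ x → x < p → q < f x

-- In permutation terms an addable cell (p, q) of dom(f) is a left-to-right minimum f(p) = q.
LeftToRightMin : (ℕ → ℕ) → ℕ → ℕ → Set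
LeftToRightMin f p q = 1 ≤ p × f p ≡ q × ExceedsBelow f p q

Dom⇒ExceedsBelow : ∀ f {a b} → Dom f a b → ExceedsBelow (perm f) (suc a) b
Dom⇒ExceedsBelow _ (_ , 1≤b , rectangle) x 1≤x x<1+a =
  proj₁ (proj₂ (proj₂ (rectangle x _ 1≤x (s≤s⁻¹ x<1+a) 1≤b ≤-refl)))

module _ (f : Perm) (f0≡0 : perm f 0 ≡ 0) where

  perm-positive : ∀ {x} → 1 ≤ x → 1 ≤ perm f x
  perm-positive 1≤x =
    n≢0⇒n>0 (λ fx≡0 → <⇒≢ 1≤x (sym (perm-injective f (trans fx≡0 (sym f0≡0)))))

  perm⁻¹-positive : ∀ {y} → 1 ≤ y → 1 ≤ perm⁻¹ f y
  perm⁻¹-positive {y} 1≤y = n≢0⇒n>0 λ f⁻¹y≡0 →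
    <⇒≢ 1≤y (trans (sym f0≡0) (trans (cong (perm f) (sym f⁻¹y≡0)) (Inverse.strictlyInverseˡ f y)))

  ExceedsBelow⇒Dom : ∀ {a b} → 1 ≤ a → 1 ≤ b → ExceedsBelow (perm f) (suc a) b → Dom f a b
  ExceedsBelow⇒Dom {a} {b} 1≤a 1≤b exceeds = 1≤a , 1≤b , rectangle
    where
    rectangle : ∀ x y → 1 ≤ x → x ≤ a → 1 ≤ y → y ≤ b → D f x y
    rectangle x y 1≤x x≤a 1≤y y≤b =
      1≤x , 1≤y , <-≤-trans (s≤s y≤b) (exceeds x 1≤x (s≤s x≤a)) ,
      ≤-<-trans x≤a (≰⇒> λ f⁻¹y≤a →
        <⇒≱ (exceeds _ (perm⁻¹-positive 1≤y) (s≤s f⁻¹y≤a))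
            (subst (_≤ b) (sym (Inverse.strictlyInverseˡ f y)) y≤b))

  addable⇒LeftToRightMin : ∀ {p q} → Addable (Dom f) p q → LeftToRightMin (perm f) p q
  addable⇒LeftToRightMin {suc p} {q} (1≤p , 1≤q , ¬dom , up , left) =
    1≤p , ≤-antisym (≮⇒≥ q≮fp) (q≤fp q left) , exceeds
    where
    exceeds : ExceedsBelow (perm f) (suc p) q
    exceeds x 1≤x x<1+p = Dom⇒ExceedsBelow f (up (s≤s (≤-trans 1≤x (s≤s⁻¹ x<1+p)))) x 1≤x x<1+p
    q≮fp : ¬ (q < perm f (suc p))
    q≮fp q<fp = ¬dom (ExceedsBelow⇒Dom 1≤p 1≤q λ x 1≤x x<2+p →
      [ exceeds x 1≤x , (λ { refl → q<fp }) ]′ (m<1+n⇒m<n∨m≡n x<2+p))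
    q≤fp : ∀ q → (1 < q → Dom f (suc p) (q ∸ 1)) → q ≤ perm f (suc p)
    q≤fp zero _ = z≤n
    q≤fp (suc zero) _ = perm-positive 1≤p
    q≤fp (suc (suc q)) left = Dom⇒ExceedsBelow f (left (s≤s (s≤s z≤n))) (suc p) 1≤p ≤-refl

  LeftToRightMin⇒addable : ∀ {p q} → LeftToRightMin (perm f) p q → Addable (Dom f) p q
  LeftToRightMin⇒addable {suc p} {q} (1≤p , fp≡q , exceeds) =
    1≤p , 1≤q , ¬dom , up , left q fp≡q exceeds
    where
    1≤q : 1 ≤ q
    1≤q = subst (1 ≤_) fp≡q (perm-positive 1≤p)
    ¬dom : ¬ Dom f (suc p) q
    ¬dom dom = <-irrefl (sym fp≡q) (Dom⇒ExceedsBelow f dom (suc p) 1≤p ≤-refl)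
    up : 1 < suc p → Dom f p q
    up 1<1+p = ExceedsBelow⇒Dom (s≤s⁻¹ 1<1+p) 1≤q exceeds
    left : ∀ q → perm f (suc p) ≡ q → ExceedsBelow (perm f) (suc p) q → 1 < q → Dom f (suc p) (q ∸ 1)
    left (suc zero) _ _ (s≤s ())
    left (suc (suc q)) fp≡q exceeds _ = ExceedsBelow⇒Dom 1≤p (s≤s z≤n) λ x 1≤x x<2+p →
      [ <-trans (n<1+n _) ∘ exceeds x 1≤x , (λ { refl → ≤-reflexive (sym fp≡q) }) ]′ (m<1+n⇒m<n∨m≡n x<2+p)

prefixSum : (ℕ → ℕ) → ℕ → ℕ
prefixSum f zero = 0
prefixSum f (suc p) = f (suc p) + prefixSum f p

prefixSum-cong : ∀ {f g} p → (∀ x → 1 ≤ x → x ≤ p → f x ≡ g x) → prefixSum f p ≡ prefixSum g p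
prefixSum-cong zero _ = refl
prefixSum-cong (suc p) f≡g =
  cong₂ _+_ (f≡g (suc p) (s≤s z≤n) ≤-refl)
            (prefixSum-cong p λ x 1≤x x≤p → f≡g x 1≤x (m≤n⇒m≤1+n x≤p))

prefixSum-< : ∀ {f g p} → 1 ≤ p → (∀ x → 1 ≤ x → x < p → f x ≡ g x) → f p < g p →
              prefixSum f p < prefixSum g p
prefixSum-< {p = suc p} _ f≡g fp<gp =
  +-mono-<-≤ fp<gp (≤-reflexive (prefixSum-cong p λ x 1≤x x≤p → f≡g x 1≤x (s≤s x≤p)))

module PrefixSumSwap (u : ℕ → ℕ) {a b} (1≤a : 1 ≤ a) (a<b : a < b) where

  private
    v : ℕ → ℕ
    v = u ∘ t a b

  below : ∀ {p} → p < a → prefixSum v p ≡ prefixSum u p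
  below p<a = prefixSum-cong _ λ x _ x≤p →
    let x<a = ≤-<-trans x≤p p<a in cong u (t-fix (<⇒≢ x<a) (<⇒≢ (<-trans x<a a<b)))

  -- On [a, b) the swap raises the prefix sum by u b ∸ u a; stated additively to avoid truncation.
  within : ∀ {p} → a ≤ p → p < b → prefixSum v p + u a ≡ prefixSum u p + u b
  within {zero} a≤0 _ = contradiction (≤-trans 1≤a a≤0) λ ()
  within {suc p} a≤1+p 1+p<b with m≤n⇒m<n∨m≡n a≤1+p
  ... | inj₂ refl = begin
    u (t (suc p) b (suc p)) + prefixSum v p + u (suc p)
      ≡⟨ cong₂ (λ y S → u y + S + u (suc p)) (t-applyˡ (suc p) b) (below ≤-refl) ⟩
    u b + prefixSum u p + u (suc p)
      ≡⟨ xy∙z≈zy∙x +-commutativeSemigroup (u b) _ _ ⟩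
    u (suc p) + prefixSum u p + u b ∎
    where open ≡-Reasoning
  ... | inj₁ a<1+p = begin
    v (suc p) + prefixSum v p + u a    ≡⟨ +-assoc (v (suc p)) _ _ ⟩
    v (suc p) + (prefixSum v p + u a)
      ≡⟨ cong₂ _+_ (cong u (t-fix (≢-sym (<⇒≢ a<1+p)) (<⇒≢ 1+p<b)))
                   (within (s≤s⁻¹ a<1+p) (<-trans (n<1+n p) 1+p<b)) ⟩
    u (suc p) + (prefixSum u p + u b)  ≡⟨ +-assoc (u (suc p)) _ _ ⟨
    u (suc p) + prefixSum u p + u b ∎
    where open ≡-Reasoning

  beyond : ∀ {p} → b ≤ p → prefixSum v p ≡ prefixSum u p
  beyond {zero} b≤0 = contradiction (<-≤-trans a<b b≤0) λ ()
  beyond {suc p} b≤1+p with m≤n⇒m<n∨m≡n b≤1+p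
  ... | inj₂ refl = begin
    u (t a (suc p) (suc p)) + prefixSum v p  ≡⟨ cong (λ y → u y + prefixSum v p) (t-applyʳ a (suc p)) ⟩
    u a + prefixSum v p                      ≡⟨ +-comm (u a) _ ⟩
    prefixSum v p + u a                      ≡⟨ within (s≤s⁻¹ a<b) ≤-refl ⟩
    prefixSum u p + u (suc p)                ≡⟨ +-comm (prefixSum u p) _ ⟩
    u (suc p) + prefixSum u p ∎
    where open ≡-Reasoning
  ... | inj₁ b<1+p = cong₂ _+_ (cong u (t-fix (≢-sym (<⇒≢ (<-trans a<b b<1+p))) (≢-sym (<⇒≢ b<1+p))))
                               (beyond (s≤s⁻¹ b<1+p))

  mono : u a < u b → ∀ p → prefixSum u p ≤ prefixSum v p
  mono ua<ub p with p <? a | p <? b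
  ... | yes p<a | _ = ≤-reflexive (sym (below p<a))
  ... | no p≮a | yes p<b = +-cancelʳ-≤ (u a) _ _ (begin
    prefixSum u p + u a  ≤⟨ +-monoʳ-≤ (prefixSum u p) (<⇒≤ ua<ub) ⟩
    prefixSum u p + u b  ≡⟨ within (≮⇒≥ p≮a) p<b ⟨
    prefixSum v p + u a  ∎)
    where open ≤-Reasoning
  ... | no _ | no p≮b = ≤-reflexive (sym (beyond (≮⇒≥ p≮b)))

  strict : u a < u b → prefixSum u a < prefixSum v a
  strict ua<ub = +-cancelʳ-< (u a) _ _ (begin-strict
    prefixSum u a + u a  <⟨ +-monoʳ-< (prefixSum u a) ua<ub ⟩
    prefixSum u a + u b  ≡⟨ within ≤-refl a<b ⟨
    prefixSum v a + u a  ∎)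
    where open ≤-Reasoning

BruhatStep-mono : ∀ {u v} → BruhatStep u v → ∀ p → prefixSum u p ≤ prefixSum v p
BruhatStep-mono {u} (a , b , 1≤a , a<b , ua<ub , v≗) p =
  ≤-trans (PrefixSumSwap.mono u 1≤a a<b ua<ub p)
          (≤-reflexive (prefixSum-cong p λ x _ _ → sym (v≗ x)))

BruhatStep-strict : ∀ {u v} → BruhatStep u v → ∃[ p ] prefixSum u p < prefixSum v p
BruhatStep-strict {u} (a , b , 1≤a , a<b , ua<ub , v≗) =
  a , <-≤-trans (PrefixSumSwap.strict u 1≤a a<b ua<ub)
                (≤-reflexive (prefixSum-cong a λ x _ _ → sym (v≗ x)))

<B-mono : ∀ {u v} → u <B v → ∀ p → prefixSum u p ≤ prefixSum v p
<B-mono [ step ] = BruhatStep-mono step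
<B-mono (step ∷ steps) p = ≤-trans (BruhatStep-mono step p) (<B-mono steps p)

<B-strict : ∀ {u v} → u <B v → ∃[ p ] prefixSum u p < prefixSum v p
<B-strict [ step ] = BruhatStep-strict step
<B-strict (step ∷ steps) with BruhatStep-strict step
... | p , lt = p , <-≤-trans lt (<B-mono steps p)

<B-irrefl : ∀ {u v} → u <B v → ¬ (u ≗ v)
<B-irrefl u<v u≗v with <B-strict u<v
... | p , lt = <-irrefl (prefixSum-cong p λ x _ _ → u≗v x) lt

φ-decreasing : (f : Perm) → ∀ {k a b} → φ k (perm f) a → φ k (perm f) b → a < b →
               perm f b < perm f a
φ-decreasing f (k<a , fk<fa , _) (_ , _ , nothingBetween) a<b =
  ≤∧≢⇒< (≮⇒≥ λ fa<fb → nothingBetween _ k<a a<b (fk<fa , fa<fb))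
        (λ fb≡fa → <⇒≢ a<b (sym (perm-injective f fb≡fa)))

φ-head-max : (f : Perm) → ∀ {k a as} → Linked _<_ (a ∷ as) → All (φ k (perm f)) (a ∷ as) →
             All (λ b → perm f b ≤ perm f a) (a ∷ as)
φ-head-max f linked (φa ∷ φas) =
  ≤-refl ∷ All.zipWith (λ (a<b , φb) → <⇒≤ (φ-decreasing f φa φb a<b)) (head<tail linked , φas)

Φbar⇒<B : (f : Perm) → ∀ {k u} → 1 ≤ k → Φbar k (perm f) u → perm f <B u
Φbar⇒<B f {k} 1≤k ([] , []≢[] , _) = contradiction refl []≢[]
Φbar⇒<B f {k} 1≤k (a ∷ as , _ , linked , φs , u≗) = chain a as linked φs u≗
  where
  chain : ∀ a as {u} → Linked _<_ (a ∷ as) → All (φ k (perm f)) (a ∷ as) →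
          u ≗ perm f ∘ tprod k (a ∷ as) → perm f <B u
  chain a [] _ ((k<a , fk<fa , _) ∷ []) u≗ = [ k , a , 1≤k , k<a , fk<fa , u≗ ]
  chain a (b ∷ bs) linked@(a<b ∷ linked′) (φa ∷ φbs) u≗ =
    chain b bs linked′ φbs (λ _ → refl) ∷ʳ (k , a , 1≤k , proj₁ φa , ascent , u≗)
    where
    ascent : perm f (tprod k (b ∷ bs) k) < perm f (tprod k (b ∷ bs) a)
    ascent = subst₂ _<_
      (cong (perm f) (sym (tprod-head (proj₁ (All.head φbs)) (head<tail linked′))))
      (cong (perm f) (sym (tprod-fix k (b ∷ bs) (≢-sym (<⇒≢ (proj₁ φa))) (All.map <⇒≢ (head<tail linked)))))
      (φ-decreasing f φa (All.head φbs) a<b)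

injectiveOn⇒≤ : ∀ {m k} (f : ℕ → ℕ) → (∀ {x} → x < m → f x < k) →
                (∀ {x y} → x < m → y < m → f x ≡ f y → x ≡ y) → m ≤ k
injectiveOn⇒≤ {m} {k} f f< f-injective = Finₚ.injective⇒≤ {f = g} g-injective
  where
  g : Fin m → Fin k
  g x = fromℕ< (f< (Finₚ.toℕ<n x))
  g-injective : Injective _≡_ _≡_ g
  g-injective gx≡gy = Finₚ.toℕ-injective
    (f-injective (Finₚ.toℕ<n _) (Finₚ.toℕ<n _) (Finₚ.fromℕ<-injective _ _ _ _ gx≡gy))

InS-bounded : ∀ {n} (w : Perm) → InS n w → ∀ {x} → x ≤ n → perm w x ≤ n
InS-bounded w (_ , fixes) {x} x≤n = ≮⇒≥ λ n<wx →
  <⇒≱ (subst (_ <_) (perm-injective w (fixes _ n<wx)) n<wx) x≤n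

interval-into-[1,j]⇒n<i+j : (w : Perm) → perm w 0 ≡ 0 → ∀ {i j n} → 1 ≤ i → i ≤ n →
                            (∀ x → i ≤ x → x ≤ n → perm w x ≤ j) → n < i + j
interval-into-[1,j]⇒n<i+j w w0≡0 {i} {j} {n} 1≤i i≤n into =
  subst (_≤ i + j) (trans (+-suc i _) (cong suc (m+[n∸m]≡n i≤n))) (+-monoʳ-≤ i count)
  where
  f : ℕ → ℕ
  f x = pred (perm w (i + x))
  inInterval : ∀ {x} → x < suc (n ∸ i) → i + x ≤ n
  inInterval x≤n-i = ≤-trans (+-monoʳ-≤ i (s≤s⁻¹ x≤n-i)) (≤-reflexive (m+[n∸m]≡n i≤n))
  positive : ∀ x → 1 ≤ perm w (i + x)
  positive x = perm-positive w w0≡0 (≤-trans 1≤i (m≤m+n i x))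
  count : suc (n ∸ i) ≤ j
  count = injectiveOn⇒≤ f
    (λ {x} x≤n-i → subst (_≤ j) (sym (suc-pred _ ⦃ >-nonZero (positive x) ⦄))
                         (into (i + x) (m≤m+n i x) (inInterval x≤n-i)))
    (λ {x} {y} _ _ fx≡fy → +-cancelˡ-≡ i x y (perm-injective w
       (pred-injective ⦃ >-nonZero (positive x) ⦄ ⦃ >-nonZero (positive y) ⦄ fx≡fy)))

module Ascent (w : Perm) {i} (1≤i : 1 ≤ i) (ascent : perm w i < perm w (suc i)) where

  W V : ℕ → ℕ
  W = perm w
  V = perm (ws w i)

  V-i : V i ≡ W (suc i)
  V-i = cong W (t-applyˡ i (suc i))

  V-suc-i : V (suc i) ≡ W i
  V-suc-i = cong W (t-applyʳ i (suc i))

  V-below : ∀ {x} → x < i → V x ≡ W x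
  V-below x<i = cong W (t-fix (<⇒≢ x<i) (<⇒≢ (<-trans x<i (n<1+n i))))

  V-beyond : ∀ {x} → suc i < x → V x ≡ W x
  V-beyond i+1<x = cong W (t-fix (≢-sym (<⇒≢ (<-trans (n<1+n i) i+1<x))) (≢-sym (<⇒≢ i+1<x)))

  V∘tprod≗W∘tprod : ∀ L → All (suc i <_) L → (V ∘ tprod (suc i) L) ≗ (W ∘ tprod i (suc i ∷ L))
  V∘tprod≗W∘tprod L i+1<L x = cong W (tprod-conj i L i+1<L x)

  V∘t∘s≗W∘t : ∀ {a} → suc i < a → (V ∘ t (suc i) a ∘ s i) ≗ (W ∘ t i a)
  V∘t∘s≗W∘t {a} i+1<a x =
    trans (V∘tprod≗W∘tprod (a ∷ []) (i+1<a ∷ []) (s i x)) (cong (W ∘ t i a) (s-involutive i x))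

  addable-suc : perm w 0 ≡ 0 → ∀ {j} → Addable (Dom w) i j → Addable (Dom (ws w i)) (suc i) j
  addable-suc w0≡0 {j} add with addable⇒LeftToRightMin w w0≡0 add
  ... | _ , Wi≡j , exceeds =
    LeftToRightMin⇒addable (ws w i) (trans (V-below 1≤i) w0≡0) (s≤s z≤n , trans V-suc-i Wi≡j , exceeds′)
    where
    exceeds′ : ExceedsBelow V (suc i) j
    exceeds′ x 1≤x x<1+i with m<1+n⇒m<n∨m≡n x<1+i
    ... | inj₁ x<i = subst (j <_) (sym (V-below x<i)) (exceeds x 1≤x x<i)
    ... | inj₂ refl = subst (j <_) (sym V-i) (subst (_< W (suc i)) Wi≡j ascent)

  φ-suc-i : φ i W (suc i)
  φ-suc-i = n<1+n i , ascent , λ _ i<x x<1+i _ → <⇒≱ i<x (s≤s⁻¹ x<1+i)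

  φ-suc⇒φ : ∀ {a} → φ (suc i) V a → V a < V i → φ i W a
  φ-suc⇒φ {a} (i+1<a , Vi+1<Va , nothingBetween) Va<Vi =
    <-trans (n<1+n i) i+1<a , subst₂ _<_ V-suc-i (V-beyond i+1<a) Vi+1<Va , nothingBetween′
    where
    nothingBetween′ : ∀ x → i < x → x < a → ¬ (W i < W x × W x < W a)
    nothingBetween′ x i<x x<a (Wi<Wx , Wx<Wa) with m≤n⇒m<n∨m≡n i<x
    ... | inj₂ refl = <-asym (subst₂ _<_ (V-beyond i+1<a) V-i Va<Vi) Wx<Wa
    ... | inj₁ i+1<x = nothingBetween x i+1<x x<a
      (subst₂ _<_ (sym V-suc-i) (sym (V-beyond i+1<x)) Wi<Wx ,
       subst₂ _<_ (sym (V-beyond i+1<x)) (sym (V-beyond i+1<a)) Wx<Wa)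

  φ⇒φ-suc : ∀ {a} → φ i W a → suc i < a → φ (suc i) V a × V a < V i
  φ⇒φ-suc {a} (i<a , Wi<Wa , nothingBetween) i+1<a =
    (i+1<a , subst₂ _<_ (sym V-suc-i) (sym (V-beyond i+1<a)) Wi<Wa , nothingBetween′) ,
    subst₂ _<_ (sym (V-beyond i+1<a)) (sym V-i) Wa<Wi+1
    where
    Wa<Wi+1 : W a < W (suc i)
    Wa<Wi+1 = ≤∧≢⇒< (≮⇒≥ λ Wi+1<Wa → nothingBetween (suc i) (n<1+n i) i+1<a (ascent , Wi+1<Wa))
                    (λ Wa≡Wi+1 → <⇒≢ i+1<a (sym (perm-injective w Wa≡Wi+1)))
    nothingBetween′ : ∀ x → suc i < x → x < a → ¬ (V (suc i) < V x × V x < V a)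
    nothingBetween′ x i+1<x x<a (Vi+1<Vx , Vx<Va) = nothingBetween x (<-trans (n<1+n i) i+1<x) x<a
      (subst₂ _<_ V-suc-i (V-beyond i+1<x) Vi+1<Vx , subst₂ _<_ (V-beyond i+1<x) (V-beyond i+1<a) Vx<Va)

  descent⇔ : ∀ {u a as} → u ≗ V ∘ tprod (suc i) (a ∷ as) → Linked _<_ (a ∷ as) → suc i < a →
             Descent u i ⇔ V a < V i
  descent⇔ {u} {a} {as} u≗ linked i+1<a =
    mk⇔ (subst₂ _<_ u-suc-i u-i) (subst₂ _<_ (sym u-suc-i) (sym u-i))
    where
    u-i : u i ≡ V i
    u-i = trans (u≗ i) (cong V (tprod-fix (suc i) (a ∷ as) (<⇒≢ (n<1+n i))
      (All.map <⇒≢ (Linked⇒All <-trans (<-trans (n<1+n i) i+1<a) linked))))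
    u-suc-i : u (suc i) ≡ V a
    u-suc-i = trans (u≗ (suc i)) (cong V (tprod-head i+1<a (head<tail linked)))

  Φbar-suc⇒Φbar : (u : ℕ → ℕ) → Φbar (suc i) V u × Descent u i → Φbar i W u × V <B u
  Φbar-suc⇒Φbar u (([] , []≢[] , _) , _) = contradiction refl []≢[]
  Φbar-suc⇒Φbar u (Φbar-u@(a ∷ as , _ , linked , φs , u≗) , desc) =
    (suc i ∷ a ∷ as , (λ ()) , i+1<a ∷ linked ,
      φ-suc-i ∷ All.zipWith (λ (φb , Vb≤Va) → φ-suc⇒φ φb (≤-<-trans Vb≤Va Va<Vi))
                            (φs , φ-head-max (ws w i) linked φs) ,
      λ x → trans (u≗ x) (V∘tprod≗W∘tprod (a ∷ as) (All.map proj₁ φs) x)) ,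
    Φbar⇒<B (ws w i) (s≤s z≤n) Φbar-u
    where
    i+1<a : suc i < a
    i+1<a = proj₁ (All.head φs)
    Va<Vi : V a < V i
    Va<Vi = Equivalence.to (descent⇔ u≗ linked i+1<a) desc

  -- u agrees with V before i, but u(i) = w(a) < w(i+1) = V(i): its prefix sum at i is smaller.
  V≮B-skipping-suc-i : ∀ {u a as} → Linked _<_ (a ∷ as) → All (φ i W) (a ∷ as) → suc i < a →
                       u ≗ W ∘ tprod i (a ∷ as) → ¬ (V <B u)
  V≮B-skipping-suc-i {u} {a} {as} linked φs i+1<a u≗ V<u =
    <⇒≱ (prefixSum-< 1≤i agree ui<Vi) (<B-mono V<u i)
    where
    i<L : All (i <_) (a ∷ as)
    i<L = Linked⇒All <-trans (<-trans (n<1+n i) i+1<a) linked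
    agree : ∀ x → 1 ≤ x → x < i → u x ≡ V x
    agree x _ x<i = trans (u≗ x) (trans
      (cong W (tprod-fix i (a ∷ as) (<⇒≢ x<i) (All.map (λ i<b → <⇒≢ (<-trans x<i i<b)) i<L)))
      (sym (V-below x<i)))
    ui≡Va : u i ≡ V a
    ui≡Va = trans (u≗ i) (trans (cong W (tprod-head (<-trans (n<1+n i) i+1<a) (head<tail linked)))
                               (sym (V-beyond i+1<a)))
    ui<Vi : u i < V i
    ui<Vi = subst (_< V i) (sym ui≡Va) (proj₂ (φ⇒φ-suc (All.head φs) i+1<a))

  Φbar-through-suc-i : ∀ {u b bs} → Linked _<_ (suc i ∷ b ∷ bs) → All (φ i W) (b ∷ bs) →
                       u ≗ W ∘ tprod i (suc i ∷ b ∷ bs) → Φbar (suc i) V u × Descent u i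
  Φbar-through-suc-i {u} {b} {bs} (i+1<b ∷ linked) φs u≗ =
    (b ∷ bs , (λ ()) , linked , φs′ , u≗′) ,
    Equivalence.from (descent⇔ u≗′ linked i+1<b) (proj₂ (φ⇒φ-suc (All.head φs) i+1<b))
    where
    i+1<L : All (suc i <_) (b ∷ bs)
    i+1<L = Linked⇒All <-trans i+1<b linked
    φs′ : All (φ (suc i) V) (b ∷ bs)
    φs′ = All.zipWith (λ (φc , i+1<c) → proj₁ (φ⇒φ-suc φc i+1<c)) (φs , i+1<L)
    u≗′ : u ≗ V ∘ tprod (suc i) (b ∷ bs)
    u≗′ x = trans (u≗ x) (sym (V∘tprod≗W∘tprod (b ∷ bs) i+1<L x))

  Φbar⇒Φbar-suc : (u : ℕ → ℕ) → Φbar i W u × V <B u → Φbar (suc i) V u × Descent u i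
  Φbar⇒Φbar-suc u (([] , []≢[] , _) , _) = contradiction refl []≢[]
  Φbar⇒Φbar-suc u ((a ∷ as , _ , linked , φs , u≗) , V<u) with m≤n⇒m<n∨m≡n (proj₁ (All.head φs))
  ... | inj₁ i+1<a = ⊥-elim (V≮B-skipping-suc-i linked φs i+1<a u≗ V<u)
  Φbar⇒Φbar-suc u ((_ ∷ [] , _ , _ , _ , u≗) , V<u) | inj₂ refl =
    ⊥-elim (<B-irrefl V<u (λ x → sym (u≗ x)))
  Φbar⇒Φbar-suc u ((_ ∷ b ∷ bs , _ , linked , _ ∷ φs , u≗) , _) | inj₂ refl =
    Φbar-through-suc-i linked φs u≗

  Φ-suc⇒Φ : (v : ℕ → ℕ) → Φ (suc i) V v → Descent v i → Φ i W (v ∘ s i) × ¬ ((v ∘ s i) ≗ V)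
  Φ-suc⇒Φ v (a , φa , v≗) desc = (a , φ-suc⇒φ φa Va<Vi , vs≗) , vs≢V
    where
    i+1<a : suc i < a
    i+1<a = proj₁ φa
    Va<Vi : V a < V i
    Va<Vi = Equivalence.to (descent⇔ v≗ [-] i+1<a) desc
    vs≗ : (v ∘ s i) ≗ (W ∘ t i a)
    vs≗ x = trans (v≗ (s i x)) (V∘t∘s≗W∘t i+1<a x)
    vs≢V : ¬ ((v ∘ s i) ≗ V)
    vs≢V vs≗V = <⇒≢ (<-trans (n<1+n i) i+1<a) (perm-injective w (begin
      W i              ≡⟨ cong W (t-applyʳ i a) ⟨
      W (t i a a)      ≡⟨ vs≗ a ⟨
      v (s i a)        ≡⟨ vs≗V a ⟩
      V a              ≡⟨ V-beyond i+1<a ⟩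
      W a              ∎))
      where open ≡-Reasoning

  Φ⇒Φ-suc : (u : ℕ → ℕ) → Φ i W u → ¬ (u ≗ V) →
            ∃[ v ] ((Φ (suc i) V v × Descent v i) × (v ∘ s i) ≗ u)
  Φ⇒Φ-suc u (a , φa , u≗) u≢V with m≤n⇒m<n∨m≡n (proj₁ φa)
  ... | inj₂ refl = ⊥-elim (u≢V u≗)
  ... | inj₁ i+1<a =
    V ∘ t (suc i) a ,
    ((a , proj₁ shifted , λ _ → refl) ,
     Equivalence.from (descent⇔ (λ _ → refl) [-] i+1<a) (proj₂ shifted)) ,
    λ x → trans (V∘t∘s≗W∘t i+1<a x) (sym (u≗ x))
    where
    shifted : φ (suc i) V a × V a < V i
    shifted = φ⇒φ-suc φa i+1<a

module AlphaCell (n : ℕ) (w : Perm) (w∈Sₙ : InS n w) {i j} (add : Addable (Dom w) i j)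
                 (alpha : IsAlpha n w j) where

  private
    W : ℕ → ℕ
    W = perm w
    w0≡0 : W 0 ≡ 0
    w0≡0 = proj₁ w∈Sₙ
    1≤i : 1 ≤ i
    1≤i = proj₁ add
    Wi≡j : W i ≡ j
    Wi≡j = proj₁ (proj₂ (addable⇒LeftToRightMin w w0≡0 add))
    exceeds : ExceedsBelow W i j
    exceeds = proj₂ (proj₂ (addable⇒LeftToRightMin w w0≡0 add))

  i+j≤n : i + j ≤ n
  i+j≤n with proj₁ alpha
  ... | i′ , add′ , i′+j≤n = subst (λ k → k + j ≤ n) i′≡i i′+j≤n
    where
    i′≡i : i′ ≡ i
    i′≡i = perm-injective w (trans (proj₁ (proj₂ (addable⇒LeftToRightMin w w0≡0 add′))) (sym Wi≡j))

  private
    i≤n : i ≤ n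
    i≤n = ≤-trans (m≤m+n i j) i+j≤n

  -- A value w(i+1) < j would make (i+1, w(i+1)) an addable cell in an earlier column.
  ascent : W i < W (suc i)
  ascent with <-cmp (W (suc i)) j
  ... | tri< Wi+1<j _ _ = ⊥-elim (proj₂ alpha _ Wi+1<j (suc i , addable , bounded))
    where
    exceeds′ : ExceedsBelow W (suc i) (W (suc i))
    exceeds′ x 1≤x x<1+i with m<1+n⇒m<n∨m≡n x<1+i
    ... | inj₁ x<i = <-trans Wi+1<j (exceeds x 1≤x x<i)
    ... | inj₂ refl = subst (W (suc i) <_) (sym Wi≡j) Wi+1<j
    addable : Addable (Dom w) (suc i) (W (suc i))
    addable = LeftToRightMin⇒addable w w0≡0 (s≤s z≤n , refl , exceeds′)
    bounded : suc i + W (suc i) ≤ n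
    bounded = ≤-trans (≤-reflexive (sym (+-suc i _))) (≤-trans (+-monoʳ-≤ i Wi+1<j) i+j≤n)
  ... | tri≈ _ Wi+1≡j _ = ⊥-elim (<⇒≢ (n<1+n i) (perm-injective w (trans Wi≡j (sym Wi+1≡j))))
  ... | tri> _ _ j<Wi+1 = subst (_< W (suc i)) (sym Wi≡j) j<Wi+1

  -- If a > n then w(a) = a, and a value w(x) > j with i < x ≤ n would lie strictly between
  -- w(i) and w(a); so w would map [i, n] into [1, j].
  φ-bounded : ∀ {a} → φ i W a → a ≤ n
  φ-bounded {a} (_ , _ , nothingBetween) = ≮⇒≥ λ n<a →
    <⇒≱ (interval-into-[1,j]⇒n<i+j w w0≡0 1≤i i≤n (belowJ n<a)) i+j≤n
    where
    belowJ : n < a → ∀ x → i ≤ x → x ≤ n → W x ≤ j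
    belowJ n<a x i≤x x≤n with m≤n⇒m<n∨m≡n i≤x
    ... | inj₂ refl = ≤-reflexive Wi≡j
    ... | inj₁ i<x = ≮⇒≥ λ j<Wx → nothingBetween x i<x (≤-<-trans x≤n n<a)
      (subst (_< W x) (sym Wi≡j) j<Wx ,
       subst (W x <_) (sym (proj₂ w∈Sₙ a n<a)) (≤-<-trans (InS-bounded w w∈Sₙ x≤n) n<a))

  Φbar-fixesAbove : (u : ℕ → ℕ) → Φbar i W u → ∀ x → n < x → u x ≡ x
  Φbar-fixesAbove u (L , _ , _ , φs , u≗) x n<x =
    trans (u≗ x) (trans (cong W (tprod-fix i L (x≢ i≤n)
                                               (All.map (x≢ ∘ φ-bounded) φs)))
                        (proj₂ w∈Sₙ x n<x))
    where
    x≢ : ∀ {y} → y ≤ n → x ≢ y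
    x≢ y≤n = ≢-sym (<⇒≢ (≤-<-trans y≤n n<x))

-- The hypotheses 1 ≤ n and w ≠ w₀ only guarantee that α(w) exists, which IsAlpha already asserts.
lemma6p2 : (n : ℕ) → 1 ≤ n → (w : Perm) → InS n w → ¬ IsW0 n w →
    (i j : ℕ) → Addable (Dom w) i j → IsAlpha n w j →
    ((u : ℕ → ℕ) → Φbar i (perm w) u → ∀ x → n < x → u x ≡ x)
    × Addable (Dom (ws w i)) (suc i) j
    × ((u : ℕ → ℕ) →
        (Φbar (suc i) (perm (ws w i)) u × Descent u i)
        ⇔ (Φbar i (perm w) u × perm (ws w i) <B u))
    × ((v : ℕ → ℕ) → Φ (suc i) (perm (ws w i)) v → Descent v i →
          Φ i (perm w) (v ∘ s i) × ¬ ((v ∘ s i) ≗ perm (ws w i)))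
    × ((v v′ : ℕ → ℕ) →
          Φ (suc i) (perm (ws w i)) v → Descent v i →
          Φ (suc i) (perm (ws w i)) v′ → Descent v′ i →
          (v ∘ s i) ≗ (v′ ∘ s i) → v ≗ v′)
    × ((u : ℕ → ℕ) → Φ i (perm w) u → ¬ (u ≗ perm (ws w i)) →
          ∃[ v ] ((Φ (suc i) (perm (ws w i)) v × Descent v i) × (v ∘ s i) ≗ u))
lemma6p2 n _ w w∈Sₙ _ i j add alpha =
  Φbar-fixesAbove ,
  addable-suc (proj₁ w∈Sₙ) add ,
  (λ u → mk⇔ (Φbar-suc⇒Φbar u) (Φbar⇒Φbar-suc u)) ,
  Φ-suc⇒Φ ,
  (λ _ _ _ _ _ _ → ∘s-cancelʳ i) ,
  Φ⇒Φ-suc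
  where
  open AlphaCell n w w∈Sₙ add alpha
  open Ascent w (proj₁ add) ascent
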